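{- Let $\vec T=(\overrightarrow{v_1v_2},\dots,\overrightarrow{v_{2k-1}v_{2k}})$ be any $k$-tuple of (not necessarily distinct) edges of $\vec G$, and let $f$ send $\overrightarrow{a_{2i-1}a_{2i}}$ to $\overrightarrow{v_{2i-1}v_{2i}}$ for each $i$. If $f$ induces a homomorphism from $\vec H$ to $\vec G$ (i.e., $v_i=v_j$ whenever $a_i=a_j$), then $\mathcal Q(\vec T)=I$. Otherwise $\mathcal Q(\vec T)$ is a uniformly random element of $\mathcal G$.
   Context: $H$ is a connected finite simple graph with no leaves, vertices $1,\dots,t$, $k$ edges, oriented arbitrarily as $\vec H$ with directed edges $\overrightarrow{a_1a_2},\dots,\overrightarrow{a_{2k-1}a_{2k}}$. $\Gamma(b)=\{i:a_i=b\}$; a distinguished index $\iota(b)\in\Gamma(b)$ is fixed for each $b$. $G$ is a finite simple graph and $\vec G$ replaces each edge $vw$ by $\overrightarrow{vw},\overrightarrow{wv}$. $\mathcal G$ is a finite group of $d\times d$ complex diagonal matrices whose elements average to the zero matrix; $I$ is the identity. Hash functions $\mathcal X_1,\dots,\mathcal X_{2k}:V(G)\to\mathcal G$: for non-distinguished $i$, $\mathcal X_i$ chosen independently and uniformly from a $4k$-wise independent family with uniform values; for $i=\iota(b)$, $\mathcal X_i(v)=\prod_{j\in\Gamma(b),j\ne i}\mathcal X_j(v)^{ -1}$ ($=I$ if $\Gamma(b)=\{i\}$). $\mathcal M_i(\overrightarrow{vw})=\mathcal X_{2i-1}(v)\mathcal X_{2i}(w)$ and $\mathcal Q(\vec T)=\prod_{i=1}^k\mathcal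 M_i(\overrightarrow{v_{2i-1}v_{2i}})=\prod_{j=1}^{2k}\mathcal X_j(v_j)$. -}

module Defs where

open import Level using (0ℓ)
open import Algebra.Bundles using (AbelianGroup)
open import Data.Nat using (ℕ; zero; suc; _*_; _^_; _≤_)
open import Data.Fin using (Fin; zero; suc)
open import Data.Fin.Properties using (_≟_)
open import Data.Product using (_×_; _,_; proj₁; proj₂)
open import Data.Product.Properties using (≡-dec)
open import Data.Bool using (Bool; true; false; if_then_else_; _∧_; not)
open import Data.List using (List; []; _∷_; length; map; concatMap; allFin; lookup)
open import Data.Vec.Functional using () renaming (_∷_ to _∷ᶠ_)
open import Relation.Nullary using (Dec; does; ¬_)
open import Relation.Binary using (Decidable)
open import Relation.Binary.PropositionalEquality using (_≡_; _≢_)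

count : ∀ {A : Set} → (A → Bool) → List A → ℕ
count P [] = 0
count P (x ∷ xs) = if P x then suc (count P xs) else count P xs

allFinB : (m : ℕ) → (Fin m → Bool) → Bool
allFinB zero f = true
allFinB (suc m) f = f zero ∧ allFinB m (λ i → f (suc i))

funs : ∀ {A : Set} (m : ℕ) → List A → List (Fin m → A)
funs zero xs = (λ ()) ∷ []
funs (suc m) xs = concatMap (λ x → map (λ f → x ∷ᶠ f) (funs m xs)) xs

-- Positions 1..2k of the oriented edges of H: position (i , 0) is the
-- index 2i-1 (tail of the i-th edge), (i , 1) is 2i (head).

Pos : ℕ → Set
Pos k = Fin k × Fin 2

_≟ₚ_ : ∀ {k} → (p q : Pos k) → Dec (p ≡ q)
_≟ₚ_ = ≡-dec _≟_ _≟_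

allPos : (k : ℕ) → List (Pos k)
allPos k = concatMap (λ i → map (λ s → (i , s)) (allFin 2)) (allFin k)

tl hd : ∀ {k} → Fin k → Pos k
tl i = (i , zero)
hd i = (i , suc zero)

-- The pattern graph H on vertices Fin t with k edges, orientation given
-- by a : Pos k → Fin t  (edge i is  a (tl i) → a (hd i)).

SimpleH : ∀ {t k} → (Pos k → Fin t) → Set
SimpleH {t} {k} a =
  (∀ i → a (tl i) ≢ a (hd i)) ×
  (∀ i j → a (tl i) ≡ a (tl j) → a (hd i) ≡ a (hd j) → i ≡ j) ×
  (∀ i j → a (tl i) ≡ a (hd j) → a (hd i) ≡ a (tl j) → i ≡ j)

data Reach {t k} (a : Pos k → Fin t) (b : Fin t) : Fin t → Set where
  here  : Reach a b b
  fwd   : ∀ i → Reach a b (a (tl i)) → Reach a b (a (hd i))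
  bwd   : ∀ i → Reach a b (a (hd i)) → Reach a b (a (tl i))

ConnectedH : ∀ {t k} → (Pos k → Fin t) → Set
ConnectedH {t} a = 1 ≤ t × (∀ b c → Reach a b c)

deg : ∀ {t k} → (Pos k → Fin t) → Fin t → ℕ
deg {k = k} a b = count (λ p → does (a p ≟ b)) (allPos k)

NoLeavesH : ∀ {t k} → (Pos k → Fin t) → Set
NoLeavesH {t} a = ∀ (b : Fin t) → deg a b ≢ 1

IsHom : ∀ {t k n} → (Pos k → Fin t) → (Pos k → Fin n) → Set
IsHom {k = k} a v = ∀ (p q : Pos k) → a p ≡ a q → v p ≡ v q

SimpleGraph : ∀ {n} → (Fin n → Fin n → Bool) → Set
SimpleGraph {n} adj = (∀ v w → adj v w ≡ adj w v) × (∀ v → adj v v ≡ false)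

-- Finite abelian group (stands in for the finite group of commuting
-- diagonal matrices), with decidable equality and an enumeration
-- listing every element exactly once (up to ≈).

record FinAbGroup : Set₁ where
  field
    abGroup : AbelianGroup 0ℓ 0ℓ
  open AbelianGroup abGroup public
  field
    _≈?_  : Decidable _≈_
    elems : List Carrier
    enum  : ∀ g → count (λ h → does (g ≈? h)) elems ≡ 1

  order : ℕ
  order = length elems

module Hashing (𝔾 : FinAbGroup) where
  open FinAbGroup 𝔾

  prodFin : (m : ℕ) → (Fin m → Carrier) → Carrier
  prodFin zero f = ε
  prodFin (suc m) f = f zero ∙ prodFin m (λ i → f (suc i))

  -- K-wise independent family with uniform values: for any m ≤ K distinct
  -- points and any target values, the fraction of family members hitting
  -- all targets is exactly 1/|𝔾|^m.
  KWiseUniform : (n K : ℕ) → List (Fin n → Carrier) → Set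
  KWiseUniform n K F =
    ∀ m → m ≤ K → (xs : Fin m → Fin n) → (∀ i j → xs i ≡ xs j → i ≡ j) →
    (gs : Fin m → Carrier) →
    count (λ h → allFinB m (λ j → does (h (xs j) ≈? gs j))) F * (order ^ m)
      ≡ length F

  module _ {t k n : ℕ} (a : Pos k → Fin t) (ι : Fin t → Pos k)
           (F : List (Fin n → Carrier)) where

    -- a sample: each position p picks a member of F independently and
    -- uniformly (choices at distinguished positions are ignored, which
    -- only rescales all counts by the same factor)
    Sample : Set
    Sample = Fin k → Fin 2 → Fin (length F)

    samples : List Sample
    samples = funs k (funs 2 (allFin (length F)))

    raw : Sample → Pos k → Fin n → Carrier
    raw ω (i , s) = lookup F (ω i s)

    𝒳 : Sample → Pos k → Fin n → Carrier
    𝒳 ω p v =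
      if does (p ≟ₚ ι (a p))
      then prodFin k (λ i → prodFin 2 (λ s →
             if does (a (i , s) ≟ a p) ∧ not (does ((i , s) ≟ₚ p))
             then raw ω (i , s) v ⁻¹ else ε))
      else raw ω p v

    𝒬 : Sample → (Pos k → Fin n) → Carrier
    𝒬 ω v = prodFin k (λ i → 𝒳 ω (tl i) (v (tl i)) ∙ 𝒳 ω (hd i) (v (hd i)))

-- Regroup the product 𝒬 by hash function instead of by position. A
-- non-distinguished position q occurs twice: as 𝒳_q(v_q) in its own factor, and
-- inverted, as 𝒳_q(v_{ι(a_q)})⁻¹, inside the distinguished factor of its vertex a_q.
-- Hence 𝒬 = ∏_q 𝒳_q(v_q) 𝒳_q(v_{ι(a_q)})⁻¹ over the non-distinguished q, each
-- factor depending only on the independent choice of 𝒳_q. If f is a homomorphism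
-- every factor is I. Otherwise some q has v_q ≠ v_{ι(a_q)}; by pairwise
-- independence with uniform values that factor is uniform on 𝒢, and multiplying a
-- uniform element by independent ones keeps it uniform.
module Submission where

open import Defs
open import Data.Nat using (ℕ; zero; suc; _+_; _*_; _^_; _≤_; z≤n; s≤s; NonZero)
open import Data.Nat.Properties using (+-commutativeSemigroup; *-comm; *-assoc; *-identityʳ; *-distribʳ-+; *-cancelˡ-≡; ≤-trans; m≤m*n)
open import Data.Fin using (Fin; zero; suc; punchIn)
open import Data.Fin.Properties using (_≟_; punchInᵢ≢i; all?; ¬∀⟶∃¬)
open import Data.Bool using (Bool; true; false; if_then_else_; _∧_; not)
open import Data.Bool.Properties using (∧-zeroʳ)
open import Data.List using (List; []; _∷_; length; map; concatMap; _++_; allFin; lookup)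
open import Data.List.Properties using (length-++; length-map; map-tabulate; tabulate-lookup; length-tabulate)
open import Data.Product using (_×_; _,_; proj₁; proj₂; ∃)
open import Data.Vec.Functional using () renaming (_∷_ to _∷ᶠ_)
open import Data.Empty using (⊥-elim)
import Relation.Binary.Reasoning.Setoid
open import Function using (_∘_; id; _⇔_; mk⇔; Equivalence)
open import Relation.Nullary using (Dec; yes; no; ¬_; does)
open import Relation.Nullary.Decidable using (does-⇔; dec-false)
open import Relation.Binary.PropositionalEquality
  using (_≡_; _≢_; refl; sym; trans; cong; cong₂; module ≡-Reasoning)
open import Algebra.Properties.CommutativeSemigroup +-commutativeSemigroup
  using () renaming (interchange to +-interchange)

private variable A B C : Set

∑ˡ : List A → (A → ℕ) → ℕ
∑ˡ []       f = 0
∑ˡ (x ∷ xs) f = f x + ∑ˡ xs f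

∑ˡ-cong : ∀ (xs : List A) {f g : A → ℕ} → (∀ x → f x ≡ g x) → ∑ˡ xs f ≡ ∑ˡ xs g
∑ˡ-cong []       f≗g = refl
∑ˡ-cong (x ∷ xs) f≗g = cong₂ _+_ (f≗g x) (∑ˡ-cong xs f≗g)

∑ˡ-zero : ∀ (xs : List A) → ∑ˡ xs (λ _ → 0) ≡ 0
∑ˡ-zero []       = refl
∑ˡ-zero (x ∷ xs) = ∑ˡ-zero xs

∑ˡ-distrib-+ : ∀ (xs : List A) (f g : A → ℕ) → ∑ˡ xs (λ x → f x + g x) ≡ ∑ˡ xs f + ∑ˡ xs g
∑ˡ-distrib-+ []       f g = refl
∑ˡ-distrib-+ (x ∷ xs) f g =
  trans (cong (f x + g x +_) (∑ˡ-distrib-+ xs f g)) (+-interchange (f x) (g x) (∑ˡ xs f) (∑ˡ xs g))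

∑ˡ-comm : ∀ (xs : List A) (ys : List B) (h : A → B → ℕ) →
          ∑ˡ xs (λ x → ∑ˡ ys (h x)) ≡ ∑ˡ ys (λ y → ∑ˡ xs (λ x → h x y))
∑ˡ-comm []       ys h = sym (∑ˡ-zero ys)
∑ˡ-comm (x ∷ xs) ys h =
  trans (cong (∑ˡ ys (h x) +_) (∑ˡ-comm xs ys h))
        (sym (∑ˡ-distrib-+ ys (h x) (λ y → ∑ˡ xs (λ x′ → h x′ y))))

∑ˡ-*-const : ∀ (xs : List A) {f : A → ℕ} {o L : ℕ} → (∀ x → f x * o ≡ L) →
             ∑ˡ xs f * o ≡ length xs * L
∑ˡ-*-const []       fo≡L = refl
∑ˡ-*-const (x ∷ xs) {f} {o} fo≡L =
  trans (*-distribʳ-+ o (f x) (∑ˡ xs f)) (cong₂ _+_ (fo≡L x) (∑ˡ-*-const xs fo≡L))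

indicator : Bool → ℕ
indicator b = if b then 1 else 0

count≡∑ˡ-indicator : ∀ (P : A → Bool) xs → count P xs ≡ ∑ˡ xs (λ x → indicator (P x))
count≡∑ˡ-indicator P []       = refl
count≡∑ˡ-indicator P (x ∷ xs) with P x
... | true  = cong suc (count≡∑ˡ-indicator P xs)
... | false = count≡∑ˡ-indicator P xs

count-cong : ∀ {P Q : A → Bool} (xs : List A) → (∀ x → P x ≡ Q x) → count P xs ≡ count Q xs
count-cong {P = P} {Q} xs P≗Q = begin
  count P xs                          ≡⟨ count≡∑ˡ-indicator P xs ⟩
  ∑ˡ xs (λ x → indicator (P x))       ≡⟨ ∑ˡ-cong xs (λ x → cong indicator (P≗Q x)) ⟩
  ∑ˡ xs (λ x → indicator (Q x))       ≡⟨ sym (count≡∑ˡ-indicator Q xs) ⟩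
  count Q xs                          ∎
  where open ≡-Reasoning

count-false : ∀ (xs : List A) → count (λ _ → false) xs ≡ 0
count-false []       = refl
count-false (x ∷ xs) = count-false xs

count-∧ˡ : ∀ (b : Bool) {Q : A → Bool} (xs : List A) → count Q xs ≡ 1 →
           count (λ x → b ∧ Q x) xs ≡ indicator b
count-∧ˡ true  xs ∣Q∣≡1 = ∣Q∣≡1
count-∧ˡ false xs _     = count-false xs

count-++ : ∀ (P : A → Bool) (xs ys : List A) → count P (xs ++ ys) ≡ count P xs + count P ys
count-++ P []       ys = refl
count-++ P (x ∷ xs) ys with P x
... | true  = cong suc (count-++ P xs ys)
... | false = count-++ P xs ys

count-map : ∀ (P : B → Bool) (f : A → B) (xs : List A) → count P (map f xs) ≡ count (λ x → P (f x)) xs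
count-map P f []       = refl
count-map P f (x ∷ xs) with P (f x)
... | true  = cong suc (count-map P f xs)
... | false = count-map P f xs

count-concatMap : ∀ (P : B → Bool) (f : A → List B) (xs : List A) →
                  count P (concatMap f xs) ≡ ∑ˡ xs (λ x → count P (f x))
count-concatMap P f []       = refl
count-concatMap P f (x ∷ xs) =
  trans (count-++ P (f x) (concatMap f xs)) (cong (count P (f x) +_) (count-concatMap P f xs))

count-comm : ∀ (P : A → B → Bool) (xs : List A) (ys : List B) →
             ∑ˡ xs (λ x → count (P x) ys) ≡ ∑ˡ ys (λ y → count (λ x → P x y) xs)
count-comm P xs ys = begin
  ∑ˡ xs (λ x → count (P x) ys)                          ≡⟨ ∑ˡ-cong xs (λ x → count≡∑ˡ-indicator (P x) ys) ⟩
  ∑ˡ xs (λ x → ∑ˡ ys (λ y → indicator (P x y)))         ≡⟨ ∑ˡ-comm xs ys (λ x y → indicator (P x y)) ⟩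
  ∑ˡ ys (λ y → ∑ˡ xs (λ x → indicator (P x y)))         ≡⟨ ∑ˡ-cong ys (λ y → sym (count≡∑ˡ-indicator (λ x → P x y) xs)) ⟩
  ∑ˡ ys (λ y → count (λ x → P x y) xs)                  ∎
  where open ≡-Reasoning

length-concatMap-map : ∀ (g : A → B → C) (xs : List A) (ys : List B) →
                       length (concatMap (λ x → map (g x) ys) xs) ≡ length xs * length ys
length-concatMap-map g []       ys = refl
length-concatMap-map g (x ∷ xs) ys =
  trans (length-++ (map (g x) ys)) (cong₂ _+_ (length-map (g x) ys) (length-concatMap-map g xs ys))

module _ (𝔾 : FinAbGroup) where
  open FinAbGroup 𝔾 renaming (refl to ≈-refl; sym to ≈-sym; trans to ≈-trans; reflexive to ≈-reflexive)
  open Hashing 𝔾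
  open import Algebra.Properties.Group group using (x≈z//y; //-rightDividesˡ; //-rightDividesʳ)
  open import Algebra.Properties.CommutativeMonoid.Sum commutativeMonoid
    using (sum-cong-≋; sum-cong-≗; ∑-distrib-+; ∑-comm; sum-remove; sum-replicate-zero)
    renaming (sum to ∏)
  module ≈-Reasoning = Relation.Binary.Reasoning.Setoid setoid

  order-nonZero : NonZero order
  order-nonZero with elems | enum ε
  ... | _ ∷ _ | _ = _

  Uniform : (A → Carrier) → List A → Set
  Uniform h ys = ∀ c → count (λ y → does (h y ≈? c)) ys * order ≡ length ys

  does-≈?-cong : ∀ {x y c d} → (x ≈ c ⇔ y ≈ d) → does (x ≈? c) ≡ does (y ≈? d)
  does-≈?-cong x≈c⇔y≈d = does-⇔ x≈c⇔y≈d (_ ≈? _) (_ ≈? _)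

  Uniform-cong : ∀ {h h′ : A → Carrier} ys → (∀ y → h y ≈ h′ y) → Uniform h ys → Uniform h′ ys
  Uniform-cong ys h≈h′ unif c =
    trans (cong (_* order) (count-cong ys λ y →
             does-≈?-cong (mk⇔ (≈-trans (h≈h′ y)) (≈-trans (≈-sym (h≈h′ y))))))
          (unif c)

  Uniform-∙ʳ : ∀ {h : A → Carrier} ys r → Uniform h ys → Uniform (λ y → h y ∙ r) ys
  Uniform-∙ʳ {h = h} ys r unif c =
    trans (cong (_* order) (count-cong ys λ y →
             does-≈?-cong (mk⇔ (x≈z//y (h y) r c) λ hy≈c/r → ≈-trans (∙-congʳ hy≈c/r) (//-rightDividesˡ r c))))
          (unif (c ∙ r ⁻¹))

  Uniform-∙ˡ : ∀ {h : A → Carrier} ys r → Uniform h ys → Uniform (λ y → r ∙ h y) ys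
  Uniform-∙ˡ {h = h} ys r unif = Uniform-cong ys (λ y → comm (h y) r) (Uniform-∙ʳ ys r unif)

  Uniform-concatMapʳ : ∀ {H : B → Carrier} (g : A → C → B) xs ys →
                       (∀ x → Uniform (λ y → H (g x y)) ys) →
                       Uniform H (concatMap (λ x → map (g x) ys) xs)
  Uniform-concatMapʳ {B = B} {H = H} g xs ys unif c = begin
    count P (concatMap (λ x → map (g x) ys) xs) * order    ≡⟨ cong (_* order) (count-concatMap P _ xs) ⟩
    ∑ˡ xs (λ x → count P (map (g x) ys)) * order           ≡⟨ ∑ˡ-*-const xs (λ x → trans (cong (_* order) (count-map P (g x) ys)) (unif x c)) ⟩
    length xs * length ys                                  ≡⟨ sym (length-concatMap-map g xs ys) ⟩
    length (concatMap (λ x → map (g x) ys) xs)             ∎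
    where
    open ≡-Reasoning
    P : B → Bool
    P b = does (H b ≈? c)

  Uniform-concatMapˡ : ∀ {H : B → Carrier} (g : A → C → B) xs ys →
                       (∀ y → Uniform (λ x → H (g x y)) xs) →
                       Uniform H (concatMap (λ x → map (g x) ys) xs)
  Uniform-concatMapˡ {B = B} {H = H} g xs ys unif c = begin
    count P (concatMap (λ x → map (g x) ys) xs) * order    ≡⟨ cong (_* order) (count-concatMap P _ xs) ⟩
    ∑ˡ xs (λ x → count P (map (g x) ys)) * order           ≡⟨ cong (_* order) (∑ˡ-cong xs (λ x → count-map P (g x) ys)) ⟩
    ∑ˡ xs (λ x → count (λ y → P (g x y)) ys) * order       ≡⟨ cong (_* order) (count-comm (λ x y → P (g x y)) xs ys) ⟩
    ∑ˡ ys (λ y → count (λ x → P (g x y)) xs) * order       ≡⟨ ∑ˡ-*-const ys (λ y → unif y c) ⟩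
    length ys * length xs                                  ≡⟨ *-comm (length ys) (length xs) ⟩
    length xs * length ys                                  ≡⟨ sym (length-concatMap-map g xs ys) ⟩
    length (concatMap (λ x → map (g x) ys) xs)             ∎
    where
    open ≡-Reasoning
    P : B → Bool
    P b = does (H b ≈? c)

  Uniform-funs : ∀ m (f : Fin m → A → Carrier) xs (i₀ : Fin m) → Uniform (f i₀) xs →
                 Uniform (λ φ → ∏ (λ i → f i (φ i))) (funs m xs)
  Uniform-funs (suc m) f xs zero unif =
    Uniform-concatMapˡ _∷ᶠ_ xs (funs m xs) λ φ → Uniform-∙ʳ xs (∏ (λ i → f (suc i) (φ i))) unif
  Uniform-funs (suc m) f xs (suc i₀) unif =
    Uniform-concatMapʳ _∷ᶠ_ xs (funs m xs) λ x → Uniform-∙ˡ (funs m xs) (f zero x) (Uniform-funs m (f ∘ suc) xs i₀ unif)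

  Uniform-lookup : ∀ {n} {H : (Fin n → Carrier) → Carrier} (F : List (Fin n → Carrier)) →
                   Uniform H F → Uniform (H ∘ lookup F) (allFin (length F))
  Uniform-lookup {n} {H} F unif c = begin
    count (P ∘ lookup F) (allFin (length F)) * order    ≡⟨ cong (_* order) (count-map P (lookup F) (allFin (length F))) ⟨
    count P (map (lookup F) (allFin (length F))) * order ≡⟨ cong (λ hs → count P hs * order) map-lookup-allFin ⟩
    count P F * order                                    ≡⟨ unif c ⟩
    length F                                             ≡⟨ length-tabulate {n = length F} id ⟨
    length (allFin (length F))                           ∎
    where
    open ≡-Reasoning
    P : (Fin n → Carrier) → Bool
    P h = does (H h ≈? c)
    map-lookup-allFin : map (lookup F) (allFin (length F)) ≡ F
    map-lookup-allFin = trans (map-tabulate id (lookup F)) (tabulate-lookup F)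

  count-by-value : ∀ (φ : A → Carrier) (P : A → Bool) xs →
                   count P xs ≡ ∑ˡ elems (λ g → count (λ x → P x ∧ does (φ x ≈? g)) xs)
  count-by-value φ P xs = begin
    count P xs                                                ≡⟨ count≡∑ˡ-indicator P xs ⟩
    ∑ˡ xs (λ x → indicator (P x))                             ≡⟨ ∑ˡ-cong xs (λ x → sym (count-∧ˡ (P x) elems (enum (φ x)))) ⟩
    ∑ˡ xs (λ x → count (λ g → P x ∧ does (φ x ≈? g)) elems)  ≡⟨ count-comm (λ x g → P x ∧ does (φ x ≈? g)) xs elems ⟩
    ∑ˡ elems (λ g → count (λ x → P x ∧ does (φ x ≈? g)) xs)  ∎
    where open ≡-Reasoning

  //≈⇔≈∙ : ∀ {x y c} → x ∙ y ⁻¹ ≈ c ⇔ x ≈ c ∙ y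
  //≈⇔≈∙ {x} {y} {c} = mk⇔
    (λ x/y≈c → ≈-trans (≈-sym (//-rightDividesˡ y x)) (∙-congʳ x/y≈c))
    (λ x≈cy → ≈-trans (∙-congʳ x≈cy) (//-rightDividesʳ y c))

  Uniform-quotient : ∀ {n K} (F : List (Fin n → Carrier)) → KWiseUniform n K F → 2 ≤ K →
                     ∀ {u w} → u ≢ w → Uniform (λ h → h u ∙ h w ⁻¹) F
  Uniform-quotient {n} F kwise 2≤K {u} {w} u≢w c = *-cancelˡ-≡ _ _ order {{order-nonZero}} (begin
    order * (count Q F * order)                                   ≡⟨ *-comm order _ ⟩
    count Q F * order * order                                     ≡⟨ *-assoc (count Q F) order order ⟩
    count Q F * (order * order)                                   ≡⟨ cong (λ m → count Q F * (order * m)) (sym (*-identityʳ order)) ⟩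
    count Q F * order ^ 2                                         ≡⟨ cong (_* order ^ 2) (count-by-value (λ h → h w) Q F) ⟩
    ∑ˡ elems (λ g → count (λ h → Q h ∧ does (h w ≈? g)) F) * order ^ 2
      ≡⟨ ∑ˡ-*-const elems (λ g → trans (cong (_* order ^ 2) (count-cong F (joint g)))
                                       (kwise 2 2≤K points points-injective (targets g))) ⟩
    order * length F                                              ∎)
    where
    open ≡-Reasoning
    Q : (Fin n → Carrier) → Bool
    Q h = does ((h u ∙ h w ⁻¹) ≈? c)
    points : Fin 2 → Fin n
    points = u ∷ᶠ w ∷ᶠ λ ()
    points-injective : ∀ i j → points i ≡ points j → i ≡ j
    points-injective zero       zero       _   = refl
    points-injective zero       (suc zero) u≡w = ⊥-elim (u≢w u≡w)
    points-injective (suc zero) zero       w≡u = ⊥-elim (u≢w (sym w≡u))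
    points-injective (suc zero) (suc zero) _   = refl
    targets : Carrier → Fin 2 → Carrier
    targets g = c ∙ g ∷ᶠ g ∷ᶠ λ ()
    joint : ∀ g h → Q h ∧ does (h w ≈? g) ≡ does (h u ≈? (c ∙ g)) ∧ (does (h w ≈? g) ∧ true)
    joint g h with h w ≈? g
    ... | yes hw≈g = cong (_∧ true) (does-≈?-cong (mk⇔ (λ q → ≈-trans (Equivalence.to //≈⇔≈∙ q) (∙-congˡ hw≈g))
                                                         (λ p → Equivalence.from //≈⇔≈∙ (≈-trans p (∙-congˡ (≈-sym hw≈g))))))
    ... | no _     = trans (∧-zeroʳ (Q h)) (sym (∧-zeroʳ _))

  prodFin≡∏ : ∀ m (f : Fin m → Carrier) → prodFin m f ≡ ∏ f
  prodFin≡∏ zero    f = refl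
  prodFin≡∏ (suc m) f = cong (f zero ∙_) (prodFin≡∏ m (f ∘ suc))

  ∏-ε : ∀ {m} {f : Fin m → Carrier} → (∀ i → f i ≈ ε) → ∏ f ≈ ε
  ∏-ε {m} f≈ε = ≈-trans (sum-cong-≋ f≈ε) (sum-replicate-zero m)

  ∏-single : ∀ {m} (f : Fin m → Carrier) i → (∀ j → j ≢ i → f j ≈ ε) → ∏ f ≈ f i
  ∏-single {suc m} f i off = ≈-trans (sum-remove {i = i} f)
    (≈-trans (∙-congˡ (∏-ε (λ j → off (punchIn i j) (punchInᵢ≢i i j)))) (identityʳ (f i)))

  ∏² : ∀ {m l} → (Fin m × Fin l → Carrier) → Carrier
  ∏² f = ∏ λ i → ∏ λ s → f (i , s)

  module _ {m l : ℕ} where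
    ∏²-cong : ∀ {f g : Fin m × Fin l → Carrier} → (∀ q → f q ≈ g q) → ∏² f ≈ ∏² g
    ∏²-cong f≈g = sum-cong-≋ λ i → sum-cong-≋ λ s → f≈g (i , s)

    ∏²-ε : ∀ {f : Fin m × Fin l → Carrier} → (∀ q → f q ≈ ε) → ∏² f ≈ ε
    ∏²-ε f≈ε = ∏-ε λ i → ∏-ε λ s → f≈ε (i , s)

    ∏²-distrib : ∀ (f g : Fin m × Fin l → Carrier) → ∏² (λ q → f q ∙ g q) ≈ ∏² f ∙ ∏² g
    ∏²-distrib f g = ≈-trans (sum-cong-≋ λ i → ∑-distrib-+ (λ s → f (i , s)) (λ s → g (i , s)))
                             (∑-distrib-+ (λ i → ∏ λ s → f (i , s)) (λ i → ∏ λ s → g (i , s)))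

    ∏²-comm : ∀ (f : Fin m × Fin l → Fin m × Fin l → Carrier) →
              ∏² (λ p → ∏² (f p)) ≈ ∏² (λ q → ∏² (λ p → f p q))
    ∏²-comm f = begin
      ∏ (λ i → ∏ λ s → ∏ λ j → ∏ λ t → f (i , s) (j , t))
        ≈⟨ sum-cong-≋ (λ i → ∑-comm λ s j → ∏ λ t → f (i , s) (j , t)) ⟩
      ∏ (λ i → ∏ λ j → ∏ λ s → ∏ λ t → f (i , s) (j , t))
        ≈⟨ sum-cong-≋ (λ i → sum-cong-≋ λ j → ∑-comm λ s t → f (i , s) (j , t)) ⟩
      ∏ (λ i → ∏ λ j → ∏ λ t → ∏ λ s → f (i , s) (j , t))
        ≈⟨ ∑-comm (λ i j → ∏ λ t → ∏ λ s → f (i , s) (j , t)) ⟩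
      ∏ (λ j → ∏ λ i → ∏ λ t → ∏ λ s → f (i , s) (j , t))
        ≈⟨ sum-cong-≋ (λ j → ∑-comm λ i t → ∏ λ s → f (i , s) (j , t)) ⟩
      ∏ (λ j → ∏ λ t → ∏ λ i → ∏ λ s → f (i , s) (j , t))  ∎
      where open ≈-Reasoning

    ∏²-single : ∀ (f : Fin m × Fin l → Carrier) q₀ → (∀ q → q ≢ q₀ → f q ≈ ε) → ∏² f ≈ f q₀
    ∏²-single f (i₀ , s₀) off =
      ≈-trans (∏-single _ i₀ λ i i≢i₀ → ∏-ε λ s → off (i , s) (i≢i₀ ∘ cong proj₁))
              (∏-single _ s₀ λ s s≢s₀ → off (i₀ , s) (s≢s₀ ∘ cong proj₂))

  module Cancellation {t k n} (a : Pos k → Fin t) (ι : Fin t → Pos k) (a∘ι≗id : ∀ b → a (ι b) ≡ b)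
                      (F : List (Fin n → Carrier)) (v : Pos k → Fin n) where

    distinguished? : (q : Pos k) → Dec (q ≡ ι (a q))
    distinguished? q = q ≟ₚ ι (a q)

    residue : Pos k → (Fin n → Carrier) → Carrier
    residue q h = if does (distinguished? q) then ε else h (v q) ∙ h (v (ι (a q))) ⁻¹

    module _ (ω : Sample a ι F) where

      -- 𝒳_p(v_p) = ∏_q cancelling p q ∙ own p; collecting the factors of hash q over all p
      -- leaves returned q, which pairs with own q to give residue q.
      compensation : Pos k → Pos k → Carrier
      compensation p q = if does (a q ≟ a p) ∧ not (does (q ≟ₚ p)) then raw a ι F ω q (v p) ⁻¹ else ε

      cancelling : Pos k → Pos k → Carrier
      cancelling p q = if does (distinguished? p) then compensation p q else ε

      own : Pos k → Carrier
      own p = if does (distinguished? p) then ε else raw a ι F ω p (v p)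

      returned : Pos k → Carrier
      returned q = if does (distinguished? q) then ε else raw a ι F ω q (v (ι (a q))) ⁻¹

      𝒳-split : ∀ p → 𝒳 a ι F ω p (v p) ≈ ∏² (cancelling p) ∙ own p
      𝒳-split p = ≈-trans (≈-reflexive (cong (λ x → if does (distinguished? p) then x else raw a ι F ω p (v p))
                                             prodFin²≡∏²))
                          (split (does (distinguished? p)))
        where
        prodFin²≡∏² : prodFin k (λ i → prodFin 2 (λ s → compensation p (i , s))) ≡ ∏² (compensation p)
        prodFin²≡∏² = trans (prodFin≡∏ k _) (sum-cong-≗ λ i → prodFin≡∏ 2 (λ s → compensation p (i , s)))
        split : ∀ b → (if b then ∏² (compensation p) else raw a ι F ω p (v p))
                      ≈ ∏² (λ q → if b then compensation p q else ε) ∙ (if b then ε else raw a ι F ω p (v p))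
        split true  = ≈-sym (identityʳ _)
        split false = ≈-sym (≈-trans (∙-congʳ (∏²-ε {k} {2} λ _ → ≈-refl)) (identityˡ _))

      cancelling-returned : ∀ q → ∏² (λ p → cancelling p q) ≈ returned q
      cancelling-returned q =
        ≈-trans (∏²-single _ (ι (a q)) λ p p≢ιaq → off p p≢ιaq (distinguished? p) (a q ≟ a p))
                (on (distinguished? (ι (a q))) (a q ≟ a (ι (a q))) (distinguished? q))
        where
        off : ∀ p → p ≢ ι (a q) → (d : Dec (p ≡ ι (a p))) (e : Dec (a q ≡ a p)) →
              (if does d then (if does e ∧ not (does (q ≟ₚ p)) then raw a ι F ω q (v p) ⁻¹ else ε) else ε) ≈ ε
        off p p≢ιaq (no _)       _              = ≈-refl
        off p p≢ιaq (yes _)      (no _)         = ≈-refl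
        off p p≢ιaq (yes p≡ιap)  (yes aq≡ap)    = ⊥-elim (p≢ιaq (trans p≡ιap (cong ι (sym aq≡ap))))
        on : (d : Dec (ι (a q) ≡ ι (a (ι (a q))))) (e : Dec (a q ≡ a (ι (a q)))) (d′ : Dec (q ≡ ι (a q))) →
             (if does d then (if does e ∧ not (does d′) then raw a ι F ω q (v (ι (a q))) ⁻¹ else ε) else ε)
               ≈ (if does d′ then ε else raw a ι F ω q (v (ι (a q))) ⁻¹)
        on (no ¬d) _      _       = ⊥-elim (¬d (cong ι (sym (a∘ι≗id (a q)))))
        on (yes _) (no ¬e) _      = ⊥-elim (¬e (sym (a∘ι≗id (a q))))
        on (yes _) (yes _) (yes _) = ≈-refl
        on (yes _) (yes _) (no _)  = ≈-refl

      returned-own : ∀ q → returned q ∙ own q ≈ residue q (raw a ι F ω q)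
      returned-own q = go (does (distinguished? q))
        where
        go : ∀ b → (if b then ε else raw a ι F ω q (v (ι (a q))) ⁻¹) ∙ (if b then ε else raw a ι F ω q (v q))
                   ≈ (if b then ε else raw a ι F ω q (v q) ∙ raw a ι F ω q (v (ι (a q))) ⁻¹)
        go true  = identityʳ ε
        go false = comm _ _

      𝒬≈∏²𝒳 : 𝒬 a ι F ω v ≈ ∏² (λ p → 𝒳 a ι F ω p (v p))
      𝒬≈∏²𝒳 = ≈-trans (≈-reflexive (prodFin≡∏ k λ i → 𝒳ᵥ (tl i) ∙ 𝒳ᵥ (hd i)))
                      (sum-cong-≋ {k} λ i → ∙-congˡ (≈-sym (identityʳ (𝒳ᵥ (hd i)))))
        where
        𝒳ᵥ : Pos k → Carrier
        𝒳ᵥ p = 𝒳 a ι F ω p (v p)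

      𝒬≈∏²residue : 𝒬 a ι F ω v ≈ ∏² (λ q → residue q (raw a ι F ω q))
      𝒬≈∏²residue = begin
        𝒬 a ι F ω v                                   ≈⟨ 𝒬≈∏²𝒳 ⟩
        ∏² (λ p → 𝒳 a ι F ω p (v p))                 ≈⟨ ∏²-cong 𝒳-split ⟩
        ∏² (λ p → ∏² (cancelling p) ∙ own p)          ≈⟨ ∏²-distrib (λ p → ∏² (cancelling p)) own ⟩
        ∏² (λ p → ∏² (cancelling p)) ∙ ∏² own         ≈⟨ ∙-congʳ (∏²-comm cancelling) ⟩
        ∏² (λ q → ∏² (λ p → cancelling p q)) ∙ ∏² own ≈⟨ ∙-congʳ (∏²-cong cancelling-returned) ⟩
        ∏² returned ∙ ∏² own                          ≈⟨ ∏²-distrib returned own ⟨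
        ∏² (λ q → returned q ∙ own q)                 ≈⟨ ∏²-cong returned-own ⟩
        ∏² (λ q → residue q (raw a ι F ω q))          ∎
        where open ≈-Reasoning

    residue-trivial : ∀ q h → v q ≡ v (ι (a q)) → residue q h ≈ ε
    residue-trivial q h vq≡ = trivial (does (distinguished? q))
      where
      trivial : ∀ b → (if b then ε else h (v q) ∙ h (v (ι (a q))) ⁻¹) ≈ ε
      trivial true  = ≈-refl
      trivial false = ≈-trans (∙-congʳ (≈-reflexive (cong h vq≡))) (inverseʳ _)

    residue-uniform : ∀ {K} → KWiseUniform n K F → 2 ≤ K → ∀ q → v q ≢ v (ι (a q)) →
                      Uniform (residue q ∘ lookup F) (allFin (length F))
    residue-uniform kwise 2≤K q vq≢ =
      Uniform-lookup F (Uniform-cong F (λ h → ≈-reflexive (sym (residue≡ h))) (Uniform-quotient F kwise 2≤K vq≢))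
      where
      residue≡ : ∀ h → residue q h ≡ h (v q) ∙ h (v (ι (a q))) ⁻¹
      residue≡ h = cong (λ b → if b then ε else h (v q) ∙ h (v (ι (a q))) ⁻¹)
                        (dec-false (distinguished? q) (vq≢ ∘ cong v))

    𝒬-uniform : ∀ {K} → KWiseUniform n K F → 2 ≤ K → ∀ q → v q ≢ v (ι (a q)) →
                Uniform (λ ω → 𝒬 a ι F ω v) (samples a ι F)
    𝒬-uniform kwise 2≤K (i₀ , s₀) vq≢ =
      Uniform-cong (samples a ι F) (λ ω → ≈-sym (𝒬≈∏²residue ω))
        (Uniform-funs k (λ i φ → ∏ λ s → residue (i , s) (lookup F (φ s))) _ i₀
          (Uniform-funs 2 (λ s x → residue (i₀ , s) (lookup F x)) (allFin (length F)) s₀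
            (residue-uniform kwise 2≤K (i₀ , s₀) vq≢)))

    𝒬-trivial : IsHom a v → ∀ ω → 𝒬 a ι F ω v ≈ ε
    𝒬-trivial hom ω = ≈-trans (𝒬≈∏²residue ω)
      (∏²-ε λ q → residue-trivial q (raw a ι F ω q) (hom q (ι (a q)) (sym (a∘ι≗id (a q)))))

¬∀⟶∃¬² : ∀ {m l} (P : Fin m × Fin l → Set) → (∀ q → Dec (P q)) → ¬ (∀ q → P q) → ∃ λ q → ¬ P q
¬∀⟶∃¬² P P? ¬∀P
  with i , ¬∀Pi ← ¬∀⟶∃¬ _ (λ i → ∀ s → P (i , s)) (λ i → all? λ s → P? (i , s)) (λ ∀P → ¬∀P λ (i , s) → ∀P i s)
  with s , ¬Pis ← ¬∀⟶∃¬ _ (λ s → P (i , s)) (λ s → P? (i , s)) ¬∀Pi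
  = (i , s) , ¬Pis

factors-through-ι⇒IsHom : ∀ {t k n} {a : Pos k → Fin t} {v : Pos k → Fin n} (ι : Fin t → Pos k) →
                          (∀ q → v q ≡ v (ι (a q))) → IsHom a v
factors-through-ι⇒IsHom {v = v} ι v≡v∘ι∘a p q ap≡aq =
  trans (v≡v∘ι∘a p) (trans (cong (v ∘ ι) ap≡aq) (sym (v≡v∘ι∘a q)))

non-hom-witness : ∀ {t k n} {a : Pos k → Fin t} {v : Pos k → Fin n} (ι : Fin t → Pos k) →
                  ¬ IsHom a v → ∃ λ q → v q ≢ v (ι (a q))
non-hom-witness {a = a} {v} ι ¬hom =
  ¬∀⟶∃¬² _ (λ q → v q ≟ v (ι (a q))) (¬hom ∘ factors-through-ι⇒IsHom ι)

2≤4*-inhabited : ∀ {k} → Fin k → 2 ≤ 4 * k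
2≤4*-inhabited {suc k} _ = ≤-trans (s≤s (s≤s z≤n)) (m≤m*n 4 (suc k))

lemma2p2 : (𝔾 : FinAbGroup) →
    let open FinAbGroup 𝔾
        open Hashing 𝔾
    in (t k : ℕ) (a : Pos k → Fin t) →
       SimpleH a → ConnectedH a → NoLeavesH a →
       (ι : Fin t → Pos k) → (∀ b → a (ι b) ≡ b) →
       (n : ℕ) (adj : Fin n → Fin n → Bool) → SimpleGraph adj →
       (F : List (Fin n → Carrier)) → 1 ≤ length F → KWiseUniform n (4 * k) F →
       (v : Pos k → Fin n) → (∀ i → adj (v (tl i)) (v (hd i)) ≡ true) →
       (IsHom a v → ∀ (ω : Sample a ι F) → 𝒬 a ι F ω v ≈ ε) ×
       (¬ IsHom a v → ∀ (g : Carrier) →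
          count (λ ω → does (𝒬 a ι F ω v ≈? g)) (samples a ι F) * order
            ≡ length (samples a ι F))
lemma2p2 𝔾 t k a _ _ _ ι a∘ι≗id n adj _ F _ kwise v _ = 𝒬-trivial , 𝒬-uniform-off-hom
  where
  open Hashing 𝔾 using (𝒬; samples)
  open Cancellation 𝔾 a ι a∘ι≗id F v
  𝒬-uniform-off-hom : ¬ IsHom a v → Uniform 𝔾 (λ ω → 𝒬 a ι F ω v) (samples a ι F)
  𝒬-uniform-off-hom ¬hom with q₀ , vq₀≢ ← non-hom-witness ι ¬hom =
    𝒬-uniform kwise (2≤4*-inhabited (proj₁ q₀)) q₀ vq₀≢
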